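{- Let $n\ge1$. If $w\in\mathbb{Z}_+^n$ is a cyclic hyper degree, then $w\in H_n$, i.e. $w$ is the coordinate-wise sum of the elements of some subset of $\{0,1\}^n$ (equivalently, $w$ is the degree sequence of some simple hypergraph on vertex set $[n]$).
   Context: $\mathbb{Z}_+$ denotes the nonnegative integers. $H_n=\{\sum_{x\in S}x : S\subseteq\{0,1\}^n\}$ (the empty sum is the zero tuple). For $m\ge0$ and $i\ge1$, $\mathrm{bin}(m,i)$ is the $i$-th bit of $m$ counted from the least significant bit. For $i\in[n]$, $c_{i,n}$ is the list of length $2^n$ with $c_{i,n}(j)=\mathrm{bin}(j-1,i)$. A cyclic permutation of order $k\ge0$ on $[m]$ is the map $i\mapsto 1+((i+k-1)\bmod m)$. For a list $\Pi=(\pi_1,\dots,\pi_n)$ of cyclic permutations of $[2^n]$ and $i\in[2^n]$, let $\Pi(T_n,i)=(c_{n,n}(\pi_n(i)),c_{n-1,n}(\pi_{n-1}(i)),\dots,c_{1,n}(\pi_1(i)))\in\{0,1\}^n$. A tuple $d\in\mathbb{Z}_+^n$ is a cyclic hyper degree if there exist such a list $\Pi$ and indices $i\le N$ in $[2^n]$ with $d=\sum_{k=i}^{N}\Pi(T_n,k)$. -}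

module Defs where

open import Data.Nat using (ℕ; zero; suc; _+_; _∸_; _^_; _≤_; NonZero)
open import Data.Nat.DivMod using (_/_; _%_)
open import Data.Nat.Properties using (m^n≢0)
open import Data.Bool using (Bool; true; false)
open import Data.Fin using (Fin; toℕ; opposite)
open import Data.Vec using (Vec; []; _∷_; lookup; tabulate; zipWith; replicate; map)
open import Data.List using (List; upTo; foldr)
import Data.List as L
open import Data.List.Relation.Unary.Unique.Propositional using (Unique)
open import Data.Product using (Σ; _×_; ∃)
open import Relation.Binary.PropositionalEquality using (_≡_)


-- bin(m,i) : i-th bit of m (i ≥ 1), counted from the least significant bit
bin : ℕ → ℕ → ℕ
bin m i = ((m / (2 ^ (i ∸ 1))) {{m^n≢0 2 (i ∸ 1)}}) % 2

c : ℕ → ℕ → ℕ → ℕ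
c i n j = bin (j ∸ 1) i

-- cyclic permutation of order k on [m]:  i ↦ 1 + ((i + k - 1) mod m)
cyc : (m : ℕ) → .{{NonZero m}} → ℕ → ℕ → ℕ
cyc m k i = suc ((i + k ∸ 1) % m)

-- A list Π = (π_1,…,π_n) of cyclic permutations of [2^n] is given by its orders:
-- lookup ks q is the order of π_{toℕ q + 1}.
-- Π(T_n,i) = (c_{n,n}(π_n(i)), …, c_{1,n}(π_1(i))): position p (0-based) uses
-- the permutation/column index j = n - p, i.e. q = opposite p.
ΠT : (n : ℕ) → Vec ℕ n → ℕ → Vec ℕ n
ΠT n ks i = tabulate λ p →
  c (suc (toℕ (opposite p))) n (cyc (2 ^ n) {{m^n≢0 2 n}} (lookup ks (opposite p)) i)

vsum : ∀ {n} → List (Vec ℕ n) → Vec ℕ n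
vsum {n} = foldr (zipWith _+_) (replicate n 0)

range : ℕ → ℕ → List ℕ
range i N = L.map (i +_) (upTo (suc N ∸ i))

CyclicHyperDegree : (n : ℕ) → Vec ℕ n → Set
CyclicHyperDegree n d =
  Σ (Vec ℕ n) λ ks → Σ ℕ λ i → Σ ℕ λ N →
    (1 ≤ i) × (i ≤ N) × (N ≤ 2 ^ n) ×
    (d ≡ vsum (L.map (ΠT n ks) (range i N)))

toℕs : ∀ {n} → Vec Bool n → Vec ℕ n
toℕs = map λ { true → 1 ; false → 0 }

InH : (n : ℕ) → Vec ℕ n → Set
InH n w = Σ (List (Vec Bool n)) λ S → Unique S × (w ≡ vsum (L.map toℕs S))

module Submission where

-- Write T(k) = Π(T_n,k).  For k = t + 1 the coordinate belonging to π_j (of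
-- order k_j) is bit j of (t + k_j) mod 2^n.  The whole argument is that the
-- rows T(a), T(a+1), …, T(N) of a window inside [2^n] are pairwise distinct:
-- then w = T(i) + … + T(N) is the sum of a SET of 0/1 vectors, i.e. w ∈ H_n.
--
-- Distinctness is a carry argument.  If T(t+1) = T(t+d+1), then for every
-- j < n some number v (namely t + k_j) has the same bit j as v + d.  Now if
-- 2^j ∣ d, adding d to v changes bit j exactly when d/2^j is odd, so in fact
-- 2^(j+1) ∣ d.  Induction on j gives 2^n ∣ d, hence d = 0 when d < 2^n.

open import Defs
open import Data.Nat
open import Data.Nat.Properties
open import Data.Nat.DivMod
open import Data.Nat.Divisibility using (_∣_; divides; divides-refl; >⇒∤)
open import Data.Bool using (Bool; true; false)
open import Data.Fin using (Fin; toℕ; fromℕ<; opposite)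
import Data.Fin as F
open import Data.Fin.Properties using (opposite-involutive; toℕ-fromℕ<)
open import Data.Vec using (Vec; []; _∷_; head; lookup; map)
open import Data.Vec.Properties using (lookup∘tabulate)
import Data.List as L
import Data.List.Properties as LP
open import Data.List.Relation.Unary.Unique.Propositional using (Unique)
open import Data.List.Relation.Unary.Unique.Propositional.Properties using (applyUpTo⁺₁)
open import Data.Product using (∃; _,_)
open import Data.Empty using (⊥-elim)
open import Function using (_∘_)
open import Relation.Binary.PropositionalEquality

_mod2^_ : ℕ → ℕ → ℕ
x mod2^ n = (x % 2 ^ n) {{m^n≢0 2 n}}

parity-flips : ∀ a → (a % 2 + 1) % 2 ≢ a % 2
parity-flips a with a % 2 | m%n<n a 2
... | 0 | _ = λ ()
... | 1 | _ = λ ()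
... | suc (suc _) | s≤s (s≤s ())

same-parity⇒even : ∀ a q → (a + q) % 2 ≡ a % 2 → 2 ∣ q
same-parity⇒even a q h with q % 2 in q%2 | m%n<n q 2
... | 0 | _ = divides (q / 2) (trans (m≡m%n+[m/n]*n q 2) (cong (_+ q / 2 * 2) q%2))
... | 1 | _ = ⊥-elim (parity-flips a
  (trans (sym (trans (%-distribˡ-+ a q 2) (cong (λ r → (a % 2 + r) % 2) q%2))) h))
... | suc (suc _) | s≤s (s≤s ())

bin-mod : ∀ x j n → j < n → bin (x mod2^ n) (suc j) ≡ bin x (suc j)
bin-mod x j n j<n = begin
    x % 2 ^ n / 2 ^ j % 2
  ≡⟨ cong (λ y → y / 2 ^ j % 2) (%-congʳ {o = x} 2^n≡2^[n∸j]*2^j) ⟩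
    x % (2 ^ (n ∸ j) * 2 ^ j) / 2 ^ j % 2
  ≡⟨ cong (_% 2) (m%[n*o]/o≡m/o%n x (2 ^ (n ∸ j)) (2 ^ j)) ⟩
    x / 2 ^ j % 2 ^ (n ∸ j) % 2
  ≡⟨ m∣n⇒o%n%m≡o%m 2 (2 ^ (n ∸ j)) (x / 2 ^ j) 2∣2^[n∸j] ⟩
    x / 2 ^ j % 2 ∎
  where
  open ≡-Reasoning
  instance
    _ = m^n≢0 2 n
    _ = m^n≢0 2 j
    _ = m^n≢0 2 (n ∸ j)
    _ = m*n≢0 (2 ^ (n ∸ j)) (2 ^ j)
  2^n≡2^[n∸j]*2^j : 2 ^ n ≡ 2 ^ (n ∸ j) * 2 ^ j
  2^n≡2^[n∸j]*2^j = trans (cong (2 ^_) (sym (m∸n+n≡m (<⇒≤ j<n)))) (^-distribˡ-+-* 2 (n ∸ j) j)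
  2∣2^[n∸j] : 2 ∣ 2 ^ (n ∸ j)
  2∣2^[n∸j] with n ∸ j | m>n⇒m∸n≢0 j<n
  ... | zero  | n∸j≢0 = ⊥-elim (n∸j≢0 refl)
  ... | suc k | _     = divides (2 ^ k) (*-comm 2 (2 ^ k))

carry : ∀ j v d → 2 ^ j ∣ d → bin (v + d) (suc j) ≡ bin v (suc j) → 2 ^ suc j ∣ d
carry j v .(q * 2 ^ j) (divides-refl q) same-bit with same-parity⇒even (v / 2 ^ j) q bit-preserved
  where
  instance
    _ = m^n≢0 2 j
  bit-preserved : (v / 2 ^ j + q) % 2 ≡ v / 2 ^ j % 2
  bit-preserved = begin
      (v / 2 ^ j + q) % 2
    ≡⟨ cong (λ y → (v / 2 ^ j + y) % 2) (sym (m*n/n≡m q (2 ^ j))) ⟩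
      (v / 2 ^ j + q * 2 ^ j / 2 ^ j) % 2
    ≡⟨ cong (_% 2) (sym (+-distrib-/-∣ʳ v (divides q refl))) ⟩
      (v + q * 2 ^ j) / 2 ^ j % 2
    ≡⟨ same-bit ⟩
      v / 2 ^ j % 2 ∎
    where open ≡-Reasoning
... | divides-refl p = divides p (*-assoc p 2 (2 ^ j))

bits-unchanged⇒divisible : ∀ n d →
  (∀ j → j < n → ∃ λ v → bin (v + d) (suc j) ≡ bin v (suc j)) → 2 ^ n ∣ d
bits-unchanged⇒divisible zero    d _ = divides d (sym (*-identityʳ d))
bits-unchanged⇒divisible (suc n) d unchanged with unchanged n ≤-refl
... | v , same-bit =
  carry n v d (bits-unchanged⇒divisible n d (λ j j<n → unchanged j (m<n⇒m<1+n j<n))) same-bit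

multiple-below⇒zero : ∀ {m d} → d < m → m ∣ d → d ≡ 0
multiple-below⇒zero {d = zero}  _   _   = refl
multiple-below⇒zero {d = suc _} d<m m∣d = ⊥-elim (>⇒∤ d<m m∣d)

ΠT-column : ∀ n ks t (q : Fin n) →
  lookup (ΠT n ks (suc t)) (opposite q) ≡ bin ((t + lookup ks q) mod2^ n) (suc (toℕ q))
ΠT-column n ks t q =
  trans (lookup∘tabulate (column ∘ opposite) (opposite q)) (cong column (opposite-involutive q))
  where
  column : Fin n → ℕ
  column r = bin ((t + lookup ks r) mod2^ n) (suc (toℕ r))

ΠT-shift-injective : ∀ n ks t d → d < 2 ^ n → ΠT n ks (suc t) ≡ ΠT n ks (suc (t + d)) → d ≡ 0
ΠT-shift-injective n ks t d d<2^n same-row =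
  multiple-below⇒zero d<2^n (bits-unchanged⇒divisible n d unchanged)
  where
  unchanged : ∀ j → j < n → ∃ λ v → bin (v + d) (suc j) ≡ bin v (suc j)
  unchanged j j<n = t + k , (begin
      bin (t + k + d) (suc j)
    ≡⟨ cong (λ x → bin x (suc j)) t+k+d≡t+d+k ⟩
      bin (t + d + k) (suc j)
    ≡⟨ sym (bin-mod (t + d + k) j n j<n) ⟩
      bin ((t + d + k) mod2^ n) (suc j)
    ≡⟨ cong (λ i → bin ((t + d + k) mod2^ n) (suc i)) (sym (toℕ-fromℕ< j<n)) ⟩
      bin ((t + d + k) mod2^ n) (suc (toℕ q))
    ≡⟨ sym (trans (cong (λ r → lookup r (opposite q)) same-row) (ΠT-column n ks (t + d) q)) ⟩
      lookup (ΠT n ks (suc t)) (opposite q)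
    ≡⟨ ΠT-column n ks t q ⟩
      bin ((t + k) mod2^ n) (suc (toℕ q))
    ≡⟨ cong (λ i → bin ((t + k) mod2^ n) (suc i)) (toℕ-fromℕ< j<n) ⟩
      bin ((t + k) mod2^ n) (suc j)
    ≡⟨ bin-mod (t + k) j n j<n ⟩
      bin (t + k) (suc j) ∎)
    where
    open ≡-Reasoning
    q : Fin n
    q = fromℕ< j<n
    k : ℕ
    k = lookup ks q
    t+k+d≡t+d+k : t + k + d ≡ t + d + k
    t+k+d≡t+d+k = trans (+-assoc t k d) (trans (cong (t +_) (+-comm k d)) (sym (+-assoc t d k)))

ΠT-distinct : ∀ n ks {a b} → 1 ≤ a → a < b → b ≤ 2 ^ n → ΠT n ks a ≢ ΠT n ks b
ΠT-distinct n ks {suc t} {b} _ a<b b≤2^n same-row =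
  <⇒≢ d>0 (sym (ΠT-shift-injective n ks t d d<2^n
    (subst (ΠT n ks (suc t) ≡_) (cong (ΠT n ks) b≡) same-row)))
  where
  d : ℕ
  d = b ∸ suc t
  b≡ : b ≡ suc (t + d)
  b≡ = sym (m+[n∸m]≡n (<⇒≤ a<b))
  d>0 : d > 0
  d>0 = m<n⇒0<n∸m a<b
  d<2^n : d < 2 ^ n
  d<2^n = <-≤-trans (subst (d <_) (sym b≡) (m<n+m d (s≤s z≤n))) b≤2^n

range-image-unique : ∀ {A : Set} (f : ℕ → A) i N →
  (∀ {a b} → i ≤ a → a < b → b ≤ N → f a ≢ f b) → Unique (L.map f (range i N))
range-image-unique f i N injective =
  subst Unique (sym image≡) (applyUpTo⁺₁ (f ∘ (i +_)) m distinct)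
  where
  m : ℕ
  m = suc N ∸ i
  image≡ : L.map f (range i N) ≡ L.applyUpTo (f ∘ (i +_)) m
  image≡ = trans (cong (L.map f) (LP.map-applyUpTo (λ x → x) (i +_) m))
                 (LP.map-applyUpTo (i +_) f m)
  distinct : ∀ {a b} → a < b → b < m → f (i + a) ≢ f (i + b)
  distinct {a} {b} a<b b<m = injective (m≤m+n i a) (+-monoʳ-< i a<b) i+b≤N
    where
    i+b≤N : i + b ≤ N
    i+b≤N = subst (_≤ N) (+-comm b i)
              (≤-pred (m≤o∸n⇒m+n≤o (suc b) (<⇒≤ (m∸n≢0⇒n<m (m<n⇒n≢0 b<m))) b<m))

toBit : ℕ → Bool
toBit zero    = false
toBit (suc _) = true

toℕs-toBit : ∀ {m} (v : Vec ℕ m) → (∀ p → lookup v p ≤ 1) → toℕs (map toBit v) ≡ v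
toℕs-toBit []      _    = refl
toℕs-toBit (x ∷ v) bits = cong₂ _∷_ (entry x (bits F.zero)) (toℕs-toBit v (bits ∘ F.suc))
  where
  -- the entrywise action of toℕs, read off a one-element vector
  entry : ∀ x → x ≤ 1 → head (toℕs (toBit x ∷ [])) ≡ x
  entry zero          _         = refl
  entry (suc zero)    _         = refl
  entry (suc (suc _)) (s≤s ())

bin≤1 : ∀ m i → bin m i ≤ 1
bin≤1 m i = ≤-pred (m%n<n ((m / 2 ^ (i ∸ 1)) {{m^n≢0 2 (i ∸ 1)}}) 2)

ΠT-bits : ∀ n ks k p → lookup (ΠT n ks k) p ≤ 1
ΠT-bits n ks k p = subst (_≤ 1) (sym (lookup∘tabulate _ p)) (bin≤1 position (suc (toℕ (opposite p))))
  where
  position : ℕ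
  position = cyc (2 ^ n) {{m^n≢0 2 n}} (lookup ks (opposite p)) k ∸ 1

theorem8 : (n : ℕ) → 1 ≤ n → (w : Vec ℕ n) → CyclicHyperDegree n w → InH n w
theorem8 n _ w (ks , i , N , 1≤i , _ , N≤2^n , refl) = S , S-unique , w≡ΣS
  where
  row : ℕ → Vec Bool n
  row k = map toBit (ΠT n ks k)
  toℕs-row : ∀ k → toℕs (row k) ≡ ΠT n ks k
  toℕs-row k = toℕs-toBit (ΠT n ks k) (ΠT-bits n ks k)
  S : L.List (Vec Bool n)
  S = L.map row (range i N)
  S-unique : Unique S
  S-unique = range-image-unique row i N λ {a} {b} i≤a a<b b≤N same-row →
    ΠT-distinct n ks (≤-trans 1≤i i≤a) a<b (≤-trans b≤N N≤2^n)
      (trans (sym (toℕs-row a)) (trans (cong toℕs same-row) (toℕs-row b)))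
  w≡ΣS : vsum (L.map (ΠT n ks) (range i N)) ≡ vsum (L.map toℕs S)
  w≡ΣS = cong vsum (trans (LP.map-cong (sym ∘ toℕs-row) (range i N)) (LP.map-∘ (range i N)))
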